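{- There is an absolute constant $C$ such that for every integer $k\ge 1$ and every $G\in\{CC_k,CC_k^-\}$, $G$ has a maximum cut $S$ with the following properties: its blocks, in increasing order of row index, follow the pattern $([S],[\bar S-S],[\bar S],[S-\bar S])$ with block lengths $x,y,z,t$ respectively (i.e. the first $x$ rows have type $S\times S$, the next $y$ rows type $\bar S\times S$, the next $z$ rows type $\bar S\times\bar S$, and the last $t$ rows type $S\times\bar S$), where $(x,y,z,t)=\left(\tfrac{k}{3},\tfrac{k}{3},\tfrac{k}{3},0\right)+(\delta_x,\delta_y,\delta_z,0)$ with $|\delta_x|,|\delta_y|,|\delta_z|\le 1$; and the cut size satisfies $\left|cs(S)-\tfrac{5}{6}k^2\right|\le Ck$ (i.e. $cs(S)=\tfrac56 k^2+O(k)$).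
   Context: For an integer $k\ge 0$, $CC_k$ is the graph with vertex set $K\cup K'$, where $K=\{v_0,\dots,v_k\}$ and $K'=\{v'_0,\dots,v'_k\}$, $K$ and $K'$ are cliques, and $v_i$ is adjacent to $v'_j$ if and only if $j<i$; there are no other edges. $CC_k^-$ is $CC_k$ with the vertex $v'_k$ removed. These graphs are exactly the twin-free co-bipartite chain graphs. For $G\in\{CC_k,CC_k^-\}$, row $i$ of $G$ is the pair $(v_i,v'_i)$ whenever both vertices belong to $G$ (rows $0,\dots,k$ for $CC_k$, rows $0,\dots,k-1$ for $CC_k^-$). A cut of $G$ is a subset $S\subseteq V(G)$, $\bar S=V(G)\setminus S$; its cut size $cs(S)$ is the number of edges with exactly one endpoint in $S$, and a maximum cut is one of maximum cut size. With respect to $S$, each row $i$ has a type $S\times S$, $\bar S\times \bar S$, $S\times\bar S$ or $\bar S\times S$, the first coordinate indicating the side of $v_i$ and the second that of $v'_i$. A block is a maximal sequence of consecutive rows of the same type; blocks of type $S\times S$, $\bar S\times\bar S$, $S\times\bar S$, $\bar S\times S$ are denoted $[S]$, $[\bar S]$, $[S-\bar S]$, $[\bar S-S]$; the length of a block is its number of rows (an empty block has length $0$). -}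

module Defs where

open import Data.Nat using (ℕ; zero; suc; _+_; _*_; _≤_; _<_; _≡ᵇ_; _<ᵇ_)
open import Data.Fin using (Fin; toℕ)
open import Data.Bool using (Bool; true; false; not; _∧_; if_then_else_)
open import Data.List using (List; map; _++_; allFin)
open import Data.Nat.ListAction using (sum)
open import Data.Product using (_×_)
open import Relation.Binary.PropositionalEquality using (_≡_)

-- The two graphs: CC_k (full) and CC_k^- (minus, vertex v'_k removed).
data Variant : Set where
  full minus : Variant

primes : Variant → ℕ → ℕ
primes full  k = suc k
primes minus k = k

data Vertex (k m : ℕ) : Set where
  v  : Fin (suc k) → Vertex k m
  v' : Fin m → Vertex k m

adj : ∀ {k m} → Vertex k m → Vertex k m → Bool
adj (v i)  (v j)  = not (toℕ i ≡ᵇ toℕ j)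
adj (v' i) (v' j) = not (toℕ i ≡ᵇ toℕ j)
adj (v i)  (v' j) = toℕ j <ᵇ toℕ i
adj (v' j) (v i)  = toℕ j <ᵇ toℕ i

vertices : ∀ k m → List (Vertex k m)
vertices k m = map v (allFin (suc k)) ++ map v' (allFin m)

-- a cut S is given by its indicator function (true = in S)
Cut : ℕ → ℕ → Set
Cut k m = Vertex k m → Bool

-- cut size: number of edges with exactly one endpoint in S, counted as
-- pairs (u , w) with u ∈ S, w ∉ S, u ~ w (each such edge exactly once)
cs : ∀ {k m} → Cut k m → ℕ
cs {k} {m} S =
  sum (map (λ u → sum (map (λ w → if S u ∧ not (S w) ∧ adj u w then 1 else 0)
                           (vertices k m)))
           (vertices k m))

IsMaxCut : ∀ {k m} → Cut k m → Set
IsMaxCut {k} {m} S = (S' : Cut k m) → cs S' ≤ cs S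

-- Block pattern ([S],[S̄-S],[S̄],[S-S̄]) with lengths x, y, z, t = 0:
-- row r = (v_r , v'_r) (for r < m) has type
--   S×S if r < x;  S̄×S if x ≤ r < x+y;  S̄×S̄ if x+y ≤ r  (and x+y+z = m)
RowPattern : ∀ {k m} → Cut k m → ℕ → ℕ → Set
RowPattern {k} {m} S x y = (i : Fin (suc k)) (j : Fin m) → toℕ i ≡ toℕ j →
  ((toℕ j < x → (S (v i) ≡ true) × (S (v' j) ≡ true)) ×
   (x ≤ toℕ j → toℕ j < x + y → (S (v i) ≡ false) × (S (v' j) ≡ true)) ×
   (x + y ≤ toℕ j → (S (v i) ≡ false) × (S (v' j) ≡ false)))

-- |x - k/3| ≤ 1, i.e. |3x - k| ≤ 3
NearThird : ℕ → ℕ → Set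
NearThird x k = (3 * x ≤ k + 3) × (k ≤ 3 * x + 3)

-- List a cut row by row: row r is (v_r , v'_r), of type S×S, S̄×S̄, S̄×S or
-- S×S̄.  Counting each cut edge at its later endpoint (v_r meets all earlier
-- vertices, v'_r only the earlier primed ones) turns cs into a sum of row
-- gains, each depending only on how many earlier rows have each type
-- (cutCount-byRows, cost).
--
-- With I, O, U, D rows of the four types, twice the cost plus
-- U + D stays below the potential
--   6IO + U² + D² + 4UD + 4IU + 2OU + 2ID + 4OD + 2(Oa + Ib),
-- where a and b bound how far the walk U − D has strayed above and below
-- zero (certificate).  Maximising over the admissible a, b and two
-- sum-of-squares identities give 12·cs ≤ 10k² + 18k + 11 for CC_k and
-- 12·cs ≤ 10k² + 10k + 11 for CC_k^- (cut-upper).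
--
-- The pattern with x rows S×S, then y rows S̄×S, then z rows
-- S̄×S̄ has an explicit cut size; choosing x, y, z within one of k/3
-- according to k mod 3 reaches the upper bound up to rounding, so the
-- pattern is a maximum cut, and its size is 5k²/6 + O(k) with constant 3.
module Submission where

open import Defs
open import Data.Bool using (Bool; true; false; not; _∧_; _xor_; if_then_else_)
open import Data.Bool.Properties using (∧-identityʳ; ∧-zeroʳ)
open import Data.Fin using (Fin; zero; suc; toℕ; fromℕ<)
open import Data.Fin.Properties using (toℕ<n; fromℕ<-toℕ)
open import Data.List using (List; []; _∷_; map; _++_; allFin; tabulate; replicate)
open import Data.List.Properties using (map-++; map-∘; map-tabulate; ++-identityʳ)
open import Data.Nat using (ℕ; zero; suc; _+_; _*_; _∸_; _⊔_; _≤_; _<_; _≡ᵇ_; _<ᵇ_; z≤n; s≤s; _<?_; _≤?_)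
open import Data.Nat.DivMod using (_divMod_; result)
open import Data.Nat.ListAction using (sum)
open import Data.Nat.ListAction.Properties using (sum-++)
open import Data.Nat.Properties
open import Data.Nat.Tactic.RingSolver using (solve-∀)
open import Data.Product using (Σ; ∃; ∃₂; _×_; _,_; proj₁; proj₂)
open import Data.Sum using (inj₁; inj₂)
open import Function using (_∘_; id)
open import Relation.Nullary using (yes; no; contradiction)
open import Relation.Binary.PropositionalEquality
open ≡-Reasoning

𝟙 : Bool → ℕ
𝟙 b = if b then 1 else 0

<ᵇ-true : ∀ {m n} → m < n → (m <ᵇ n) ≡ true
<ᵇ-true {zero}  {suc n} _         = refl
<ᵇ-true {suc m} {suc n} (s≤s m<n) = <ᵇ-true m<n

<ᵇ-false : ∀ {m n} → n ≤ m → (m <ᵇ n) ≡ false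
<ᵇ-false {m}     {zero}  _         = refl
<ᵇ-false {suc m} {suc n} (s≤s n≤m) = <ᵇ-false n≤m

≡ᵇ-false : ∀ {m n} → m < n → (n ≡ᵇ m) ≡ false
≡ᵇ-false {zero}  {suc n} _         = refl
≡ᵇ-false {suc m} {suc n} (s≤s m<n) = ≡ᵇ-false m<n

≡ᵇ-sym : ∀ m n → (m ≡ᵇ n) ≡ (n ≡ᵇ m)
≡ᵇ-sym zero    zero    = refl
≡ᵇ-sym zero    (suc n) = refl
≡ᵇ-sym (suc m) zero    = refl
≡ᵇ-sym (suc m) (suc n) = ≡ᵇ-sym m n

cut-from-both-ends : ∀ a b c → 𝟙 (a ∧ not b ∧ c) + 𝟙 (b ∧ not a ∧ c) ≡ 𝟙 ((a xor b) ∧ c)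
cut-from-both-ends true  true  c     = refl
cut-from-both-ends false false c     = refl
cut-from-both-ends true  false true  = refl
cut-from-both-ends true  false false = refl
cut-from-both-ends false true  true  = refl
cut-from-both-ends false true  false = refl

sumBelow : ℕ → (ℕ → ℕ) → ℕ
sumBelow zero    f = 0
sumBelow (suc n) f = sumBelow n f + f n

syntax sumBelow n (λ i → e) = ∑[ i < n ] e

sumBelow-cong : ∀ n {f g : ℕ → ℕ} → (∀ i → i < n → f i ≡ g i) → sumBelow n f ≡ sumBelow n g
sumBelow-cong zero    eq = refl
sumBelow-cong (suc n) eq = cong₂ _+_ (sumBelow-cong n (λ i i<n → eq i (m<n⇒m<1+n i<n))) (eq n ≤-refl)

sumBelow-zeros : ∀ n → ∑[ i < n ] 0 ≡ 0
sumBelow-zeros zero    = refl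
sumBelow-zeros (suc n) = trans (+-identityʳ _) (sumBelow-zeros n)

sumBelow-+ : ∀ n (f g : ℕ → ℕ) → ∑[ i < n ] (f i + g i) ≡ sumBelow n f + sumBelow n g
sumBelow-+ zero    f g = refl
sumBelow-+ (suc n) f g = begin
  ∑[ i < n ] (f i + g i) + (f n + g n)       ≡⟨ cong (_+ (f n + g n)) (sumBelow-+ n f g) ⟩
  sumBelow n f + sumBelow n g + (f n + g n)  ≡⟨ interchange (sumBelow n f) (sumBelow n g) (f n) (g n) ⟩
  sumBelow n f + f n + (sumBelow n g + g n)  ∎
  where
  interchange : ∀ a b c d → a + b + (c + d) ≡ a + c + (b + d)
  interchange = solve-∀

sumBelow-swap : ∀ n m (f : ℕ → ℕ → ℕ) →
  ∑[ i < n ] (∑[ j < m ] f i j) ≡ ∑[ j < m ] (∑[ i < n ] f i j)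
sumBelow-swap zero    m f = sym (sumBelow-zeros m)
sumBelow-swap (suc n) m f = begin
  ∑[ i < n ] (∑[ j < m ] f i j) + ∑[ j < m ] f n j  ≡⟨ cong (_+ ∑[ j < m ] f n j) (sumBelow-swap n m f) ⟩
  ∑[ j < m ] (∑[ i < n ] f i j) + ∑[ j < m ] f n j  ≡⟨ sym (sumBelow-+ m _ _) ⟩
  ∑[ j < m ] (∑[ i < n ] f i j + f n j)              ∎

sumBelow-triangle : ∀ n (f : ℕ → ℕ → ℕ) →
  ∑[ i < n ] (∑[ j < n ] f i j) ≡ ∑[ i < n ] (f i i + ∑[ j < i ] (f i j + f j i))
sumBelow-triangle zero    f = refl
sumBelow-triangle (suc n) f = begin
  ∑[ i < suc n ] (∑[ j < n ] f i j + f i n)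
    ≡⟨ sumBelow-+ (suc n) _ _ ⟩
  (∑[ i < n ] (∑[ j < n ] f i j) + ∑[ j < n ] f n j) + (∑[ i < n ] f i n + f n n)
    ≡⟨ cong (λ x → (x + ∑[ j < n ] f n j) + (∑[ i < n ] f i n + f n n)) (sumBelow-triangle n f) ⟩
  (T + ∑[ j < n ] f n j) + (∑[ i < n ] f i n + f n n)
    ≡⟨ regroup T (∑[ j < n ] f n j) (∑[ i < n ] f i n) (f n n) ⟩
  T + (f n n + (∑[ j < n ] f n j + ∑[ j < n ] f j n))
    ≡⟨ cong (λ x → T + (f n n + x)) (sym (sumBelow-+ n _ _)) ⟩
  T + (f n n + ∑[ j < n ] (f n j + f j n))  ∎
  where
  T = ∑[ i < n ] (f i i + ∑[ j < i ] (f i j + f j i))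
  regroup : ∀ t a b c → (t + a) + (b + c) ≡ t + (c + (a + b))
  regroup = solve-∀

sumBelow-shift : ∀ n (f : ℕ → ℕ) → sumBelow (suc n) f ≡ f 0 + ∑[ i < n ] f (suc i)
sumBelow-shift zero    f = +-comm 0 (f 0)
sumBelow-shift (suc n) f = begin
  sumBelow (suc n) f + f (suc n)          ≡⟨ cong (_+ f (suc n)) (sumBelow-shift n f) ⟩
  f 0 + ∑[ i < n ] f (suc i) + f (suc n)  ≡⟨ +-assoc (f 0) _ _ ⟩
  f 0 + ∑[ i < suc n ] f (suc i)          ∎

sum-allFin : ∀ n (g : Fin n → ℕ) (f : ℕ → ℕ) → (∀ i → g i ≡ f (toℕ i)) →
  sum (map g (allFin n)) ≡ sumBelow n f
sum-allFin n g f eq = trans (cong sum (map-tabulate id g)) (go n g f eq)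
  where
  go : ∀ n (g : Fin n → ℕ) (f : ℕ → ℕ) → (∀ i → g i ≡ f (toℕ i)) → sum (tabulate g) ≡ sumBelow n f
  go zero    g f eq = refl
  go (suc n) g f eq = trans (cong₂ _+_ (eq zero) (go n (λ i → g (suc i)) (λ i → f (suc i)) (λ i → eq (suc i))))
                            (sym (sumBelow-shift n f))

sumBelow-cutoff : ∀ m {i} → i ≤ m → (p : ℕ → Bool) →
  ∑[ j < m ] 𝟙 (p j ∧ (j <ᵇ i)) ≡ ∑[ j < i ] 𝟙 (p j)
sumBelow-cutoff zero    z≤n p = refl
sumBelow-cutoff (suc m) {i} i≤1+m p with i ≤? m
... | yes i≤m = begin
  ∑[ j < m ] 𝟙 (p j ∧ (j <ᵇ i)) + 𝟙 (p m ∧ (m <ᵇ i))  ≡⟨ cong₂ _+_ (sumBelow-cutoff m i≤m p) (cong (λ b → 𝟙 (p m ∧ b)) (<ᵇ-false i≤m)) ⟩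
  ∑[ j < i ] 𝟙 (p j) + 𝟙 (p m ∧ false)                ≡⟨ cong (λ b → ∑[ j < i ] 𝟙 (p j) + 𝟙 b) (∧-zeroʳ (p m)) ⟩
  ∑[ j < i ] 𝟙 (p j) + 0                              ≡⟨ +-identityʳ _ ⟩
  ∑[ j < i ] 𝟙 (p j)                                  ∎
... | no i≰m rewrite ≤-antisym i≤1+m (≰⇒> i≰m) =
  sumBelow-cong (suc m) (λ j j<1+m → cong 𝟙 (trans (cong (p j ∧_) (<ᵇ-true j<1+m)) (∧-identityʳ (p j))))

Describes : ∀ {k m} → Cut k m → (ℕ → Bool) → (ℕ → Bool) → Set
Describes S s t = (∀ i → S (v i) ≡ s (toℕ i)) × (∀ j → S (v' j) ≡ t (toℕ j))

-- Every cut is described by reading off its sides (values out of range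
-- are irrelevant).
unprimedSides : ∀ {k m} → Cut k m → ℕ → Bool
unprimedSides {k} S n with n <? suc k
... | yes n<1+k = S (v (fromℕ< n<1+k))
... | no  _     = false

primedSides : ∀ {k m} → Cut k m → ℕ → Bool
primedSides {m = m} S n with n <? m
... | yes n<m = S (v' (fromℕ< n<m))
... | no  _   = false

describe : ∀ {k m} (S : Cut k m) → Describes S (unprimedSides S) (primedSides S)
describe {k} {m} S = unprimed , primed
  where
  unprimed : ∀ i → S (v i) ≡ unprimedSides S (toℕ i)
  unprimed i with toℕ i <? suc k
  ... | yes p = cong (S ∘ v) (sym (fromℕ<-toℕ i p))
  ... | no ¬p = contradiction (toℕ<n i) ¬p
  primed : ∀ j → S (v' j) ≡ primedSides S (toℕ j)
  primed j with toℕ j <? m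
  ... | yes p = cong (S ∘ v') (sym (fromℕ<-toℕ j p))
  ... | no ¬p = contradiction (toℕ<n j) ¬p

cutCount : ℕ → ℕ → (ℕ → Bool) → (ℕ → Bool) → ℕ
cutCount N M s t =
    ∑[ i < N ] (∑[ i' < N ] 𝟙 (s i ∧ not (s i') ∧ not (i ≡ᵇ i')) + ∑[ j < M ] 𝟙 (s i ∧ not (t j) ∧ (j <ᵇ i)))
  + ∑[ j < M ] (∑[ i < N ] 𝟙 (t j ∧ not (s i) ∧ (j <ᵇ i)) + ∑[ j' < M ] 𝟙 (t j ∧ not (t j') ∧ not (j ≡ᵇ j')))

cs-cutCount : ∀ {k m} (S : Cut k m) s t → Describes S s t → cs S ≡ cutCount (suc k) m s t
cs-cutCount {k} {m} S s t (onK , onK') =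
  trans (sum-vertices outgoing) (cong₂ _+_
    (sum-allFin (suc k) _ _ λ i → trans (sum-vertices (edge (v i))) (cong₂ _+_
      (sum-allFin (suc k) _ _ λ i' → cong₂ (λ a b → 𝟙 (a ∧ not b ∧ not (toℕ i ≡ᵇ toℕ i'))) (onK i) (onK i'))
      (sum-allFin m _ _ λ j → cong₂ (λ a b → 𝟙 (a ∧ not b ∧ (toℕ j <ᵇ toℕ i))) (onK i) (onK' j))))
    (sum-allFin m _ _ λ j → trans (sum-vertices (edge (v' j))) (cong₂ _+_
      (sum-allFin (suc k) _ _ λ i → cong₂ (λ a b → 𝟙 (a ∧ not b ∧ (toℕ j <ᵇ toℕ i))) (onK' j) (onK i))
      (sum-allFin m _ _ λ j' → cong₂ (λ a b → 𝟙 (a ∧ not b ∧ not (toℕ j ≡ᵇ toℕ j'))) (onK' j) (onK' j')))))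
  where
  edge : Vertex k m → Vertex k m → ℕ
  edge u w = 𝟙 (S u ∧ not (S w) ∧ adj u w)
  outgoing : Vertex k m → ℕ
  outgoing u = sum (map (edge u) (vertices k m))
  sum-vertices : (h : Vertex k m → ℕ) →
    sum (map h (vertices k m)) ≡ sum (map (h ∘ v) (allFin (suc k))) + sum (map (h ∘ v') (allFin m))
  sum-vertices h = trans (cong sum (map-++ h (map v (allFin (suc k))) (map v' (allFin m))))
    (trans (sum-++ (map h (map v (allFin (suc k)))) (map h (map v' (allFin m))))
           (sym (cong₂ _+_ (cong sum (map-∘ (allFin (suc k)))) (cong sum (map-∘ (allFin m))))))

disagree : Bool → (ℕ → Bool) → ℕ → ℕ
disagree b f i = ∑[ j < i ] 𝟙 (b xor f j)

-- Inside a clique, each cut edge is counted once, at its later endpoint.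
clique-cut : ∀ n (f : ℕ → Bool) →
  ∑[ i < n ] (∑[ i' < n ] 𝟙 (f i ∧ not (f i') ∧ not (i ≡ᵇ i'))) ≡ ∑[ i < n ] disagree (f i) f i
clique-cut n f = trans (sumBelow-triangle n _) (sumBelow-cong n λ i _ →
  cong₂ _+_ (cong 𝟙 (no-loop (f i) _)) (sumBelow-cong i λ j j<i → pair i j j<i))
  where
  no-loop : ∀ a c → (a ∧ not a ∧ c) ≡ false
  no-loop true  c = refl
  no-loop false c = refl
  pair : ∀ i j → j < i →
    𝟙 (f i ∧ not (f j) ∧ not (i ≡ᵇ j)) + 𝟙 (f j ∧ not (f i) ∧ not (j ≡ᵇ i)) ≡ 𝟙 (f i xor f j)
  pair i j j<i = begin
    𝟙 (f i ∧ not (f j) ∧ not (i ≡ᵇ j)) + 𝟙 (f j ∧ not (f i) ∧ not (j ≡ᵇ i))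
      ≡⟨ cong₂ (λ x y → 𝟙 (f i ∧ not (f j) ∧ not x) + 𝟙 (f j ∧ not (f i) ∧ not y))
               (≡ᵇ-false j<i) (trans (≡ᵇ-sym j i) (≡ᵇ-false j<i)) ⟩
    𝟙 (f i ∧ not (f j) ∧ true) + 𝟙 (f j ∧ not (f i) ∧ true)
      ≡⟨ cut-from-both-ends (f i) (f j) true ⟩
    𝟙 ((f i xor f j) ∧ true)
      ≡⟨ cong 𝟙 (∧-identityʳ _) ⟩
    𝟙 (f i xor f j) ∎

-- Between K and K', each cut edge v_i v'_j (j < i) is counted at v_i;
-- this needs every i < N to satisfy i ≤ M.
crossing-cut : ∀ N M (s t : ℕ → Bool) → N ≤ suc M →
    ∑[ i < N ] (∑[ j < M ] 𝟙 (s i ∧ not (t j) ∧ (j <ᵇ i)))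
  + ∑[ j < M ] (∑[ i < N ] 𝟙 (t j ∧ not (s i) ∧ (j <ᵇ i)))
  ≡ ∑[ i < N ] disagree (s i) t i
crossing-cut N M s t N≤1+M = begin
  ∑[ i < N ] (∑[ j < M ] 𝟙 (s i ∧ not (t j) ∧ (j <ᵇ i))) + ∑[ j < M ] (∑[ i < N ] 𝟙 (t j ∧ not (s i) ∧ (j <ᵇ i)))
    ≡⟨ cong (∑[ i < N ] (∑[ j < M ] 𝟙 (s i ∧ not (t j) ∧ (j <ᵇ i))) +_)
         (sym (sumBelow-swap N M (λ i j → 𝟙 (t j ∧ not (s i) ∧ (j <ᵇ i))))) ⟩
  ∑[ i < N ] (∑[ j < M ] 𝟙 (s i ∧ not (t j) ∧ (j <ᵇ i))) + ∑[ i < N ] (∑[ j < M ] 𝟙 (t j ∧ not (s i) ∧ (j <ᵇ i)))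
    ≡⟨ sym (sumBelow-+ N _ _) ⟩
  ∑[ i < N ] (∑[ j < M ] 𝟙 (s i ∧ not (t j) ∧ (j <ᵇ i)) + ∑[ j < M ] 𝟙 (t j ∧ not (s i) ∧ (j <ᵇ i)))
    ≡⟨ sumBelow-cong N (λ i i<N → trans (sym (sumBelow-+ M _ _)) (trans
         (sumBelow-cong M (λ j _ → cut-from-both-ends (s i) (t j) (j <ᵇ i)))
         (sumBelow-cutoff M (≤-pred (≤-trans i<N N≤1+M)) (λ j → s i xor t j)))) ⟩
  ∑[ i < N ] disagree (s i) t i ∎

cutCount-byRows : ∀ N M (s t : ℕ → Bool) → N ≤ suc M →
  cutCount N M s t ≡ ∑[ i < N ] (disagree (s i) s i + disagree (s i) t i) + ∑[ j < M ] disagree (t j) t j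
cutCount-byRows N M s t N≤1+M = begin
  cutCount N M s t
    ≡⟨ cong₂ _+_ (sumBelow-+ N _ _) (sumBelow-+ M _ _) ⟩
  (KK + KK') + (K'K + K'K')
    ≡⟨ regroup KK KK' K'K K'K' ⟩
  (KK + (KK' + K'K)) + K'K'
    ≡⟨ cong₂ (λ x y → (x + y) + K'K') (clique-cut N s) (crossing-cut N M s t N≤1+M) ⟩
  (∑[ i < N ] disagree (s i) s i + ∑[ i < N ] disagree (s i) t i) + K'K'
    ≡⟨ cong₂ _+_ (sym (sumBelow-+ N _ _)) (clique-cut M t) ⟩
  ∑[ i < N ] (disagree (s i) s i + disagree (s i) t i) + ∑[ j < M ] disagree (t j) t j ∎
  where
  KK   = ∑[ i < N ] (∑[ i' < N ] 𝟙 (s i ∧ not (s i') ∧ not (i ≡ᵇ i')))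
  KK'  = ∑[ i < N ] (∑[ j < M ] 𝟙 (s i ∧ not (t j) ∧ (j <ᵇ i)))
  K'K  = ∑[ j < M ] (∑[ i < N ] 𝟙 (t j ∧ not (s i) ∧ (j <ᵇ i)))
  K'K' = ∑[ j < M ] (∑[ j' < M ] 𝟙 (t j ∧ not (t j') ∧ not (j ≡ᵇ j')))
  regroup : ∀ a b c d → (a + b) + (c + d) ≡ (a + (b + c)) + d
  regroup = solve-∀

-- A row (v_r , v'_r) is recorded by the sides of its two vertices.
Row : Set
Row = Bool × Bool

-- Numbers of rows of each type: I of type S×S, O of type S̄×S̄,
-- U of type S̄×S and D of type S×S̄.
record Tally : Set where
  constructor tally
  field I O U D : ℕ

addRow : Row → Tally → Tally
addRow (true  , true ) (tally I O U D) = tally (suc I) O U D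
addRow (false , false) (tally I O U D) = tally I (suc O) U D
addRow (false , true ) (tally I O U D) = tally I O (suc U) D
addRow (true  , false) (tally I O U D) = tally I O U (suc D)

-- Lists of rows are written latest row first.
tallyOf : List Row → Tally
tallyOf []      = tally 0 0 0 0
tallyOf (ρ ∷ w) = addRow ρ (tallyOf w)

size : Tally → ℕ
size (tally I O U D) = I + O + U + D

unprimedAgainst : Bool → Tally → ℕ
unprimedAgainst true  (tally I O U D) = O + U
unprimedAgainst false (tally I O U D) = I + D

primedAgainst : Bool → Tally → ℕ
primedAgainst true  (tally I O U D) = O + D
primedAgainst false (tally I O U D) = I + U

-- Cut edges from a new row (σ , τ) back to the earlier rows: v_r meets
-- every earlier vertex, v'_r only the earlier primed ones.
gain : Row → Tally → ℕ
gain (σ , τ) T = unprimedAgainst σ T + primedAgainst σ T + primedAgainst τ T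

-- Cut edges from the extra vertex v_k of CC_k^- back to all rows.
lastGain : Bool → Tally → ℕ
lastGain σ T = unprimedAgainst σ T + primedAgainst σ T

cost : List Row → ℕ
cost []      = 0
cost (ρ ∷ w) = gain ρ (tallyOf w) + cost w

rows : (ℕ → Bool) → (ℕ → Bool) → ℕ → List Row
rows s t zero    = []
rows s t (suc r) = (s r , t r) ∷ rows s t r

size-rows : ∀ s t r → size (tallyOf (rows s t r)) ≡ r
size-rows s t zero    = refl
size-rows s t (suc r) = trans (size-addRow (s r , t r) (tallyOf (rows s t r))) (cong suc (size-rows s t r))
  where
  size-addRow : ∀ ρ T → size (addRow ρ T) ≡ suc (size T)
  size-addRow (true  , true ) (tally I O U D) = refl
  size-addRow (false , false) (tally I O U D) = cong (λ x → x + U + D) (+-suc I O)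
  size-addRow (false , true ) (tally I O U D) = cong (_+ D) (+-suc (I + O) U)
  size-addRow (true  , false) (tally I O U D) = +-suc (I + O + U) D

unprimedAgainst-addRow : ∀ b ρ T → unprimedAgainst b (addRow ρ T) ≡ 𝟙 (b xor proj₁ ρ) + unprimedAgainst b T
unprimedAgainst-addRow true  (true  , true ) (tally I O U D) = refl
unprimedAgainst-addRow true  (false , false) (tally I O U D) = refl
unprimedAgainst-addRow true  (false , true ) (tally I O U D) = +-suc O U
unprimedAgainst-addRow true  (true  , false) (tally I O U D) = refl
unprimedAgainst-addRow false (true  , true ) (tally I O U D) = refl
unprimedAgainst-addRow false (false , false) (tally I O U D) = refl
unprimedAgainst-addRow false (false , true ) (tally I O U D) = refl
unprimedAgainst-addRow false (true  , false) (tally I O U D) = +-suc I D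

primedAgainst-addRow : ∀ b ρ T → primedAgainst b (addRow ρ T) ≡ 𝟙 (b xor proj₂ ρ) + primedAgainst b T
primedAgainst-addRow true  (true  , true ) (tally I O U D) = refl
primedAgainst-addRow true  (false , false) (tally I O U D) = refl
primedAgainst-addRow true  (false , true ) (tally I O U D) = refl
primedAgainst-addRow true  (true  , false) (tally I O U D) = +-suc O D
primedAgainst-addRow false (true  , true ) (tally I O U D) = refl
primedAgainst-addRow false (false , false) (tally I O U D) = refl
primedAgainst-addRow false (false , true ) (tally I O U D) = +-suc I U
primedAgainst-addRow false (true  , false) (tally I O U D) = refl

disagree-unprimed : ∀ s t b r → disagree b s r ≡ unprimedAgainst b (tallyOf (rows s t r))
disagree-unprimed s t true  zero = refl
disagree-unprimed s t false zero = refl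
disagree-unprimed s t b (suc r) = begin
  disagree b s r + 𝟙 (b xor s r)                                   ≡⟨ cong (_+ 𝟙 (b xor s r)) (disagree-unprimed s t b r) ⟩
  unprimedAgainst b (tallyOf (rows s t r)) + 𝟙 (b xor s r)         ≡⟨ +-comm _ (𝟙 (b xor s r)) ⟩
  𝟙 (b xor s r) + unprimedAgainst b (tallyOf (rows s t r))         ≡⟨ sym (unprimedAgainst-addRow b (s r , t r) _) ⟩
  unprimedAgainst b (tallyOf (rows s t (suc r)))                   ∎

disagree-primed : ∀ s t b r → disagree b t r ≡ primedAgainst b (tallyOf (rows s t r))
disagree-primed s t true  zero = refl
disagree-primed s t false zero = refl
disagree-primed s t b (suc r) = begin
  disagree b t r + 𝟙 (b xor t r)                                   ≡⟨ cong (_+ 𝟙 (b xor t r)) (disagree-primed s t b r) ⟩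
  primedAgainst b (tallyOf (rows s t r)) + 𝟙 (b xor t r)           ≡⟨ +-comm _ (𝟙 (b xor t r)) ⟩
  𝟙 (b xor t r) + primedAgainst b (tallyOf (rows s t r))           ≡⟨ sym (primedAgainst-addRow b (s r , t r) _) ⟩
  primedAgainst b (tallyOf (rows s t (suc r)))                     ∎

rowContribution : ∀ s t i →
  disagree (s i) s i + disagree (s i) t i + disagree (t i) t i ≡ gain (s i , t i) (tallyOf (rows s t i))
rowContribution s t i =
  cong₂ _+_ (cong₂ _+_ (disagree-unprimed s t (s i) i) (disagree-primed s t (s i) i)) (disagree-primed s t (t i) i)

cost-rows : ∀ s t r →
  ∑[ i < r ] (disagree (s i) s i + disagree (s i) t i + disagree (t i) t i) ≡ cost (rows s t r)
cost-rows s t zero    = refl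
cost-rows s t (suc r) =
  trans (cong₂ _+_ (cost-rows s t r) (rowContribution s t r)) (+-comm (cost (rows s t r)) _)

-- Cut size of CC_{r-1}: r full rows.
cutCount-full : ∀ s t r → cutCount r r s t ≡ cost (rows s t r)
cutCount-full s t r = begin
  cutCount r r s t
    ≡⟨ cutCount-byRows r r s t (n≤1+n r) ⟩
  ∑[ i < r ] (disagree (s i) s i + disagree (s i) t i) + ∑[ j < r ] disagree (t j) t j
    ≡⟨ sym (sumBelow-+ r _ _) ⟩
  ∑[ i < r ] (disagree (s i) s i + disagree (s i) t i + disagree (t i) t i)
    ≡⟨ cost-rows s t r ⟩
  cost (rows s t r) ∎

-- Cut size of CC_r^-: r full rows followed by the single vertex v_r.
cutCount-minus : ∀ s t r → cutCount (suc r) r s t ≡ cost (rows s t r) + lastGain (s r) (tallyOf (rows s t r))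
cutCount-minus s t r = begin
  cutCount (suc r) r s t
    ≡⟨ cutCount-byRows (suc r) r s t ≤-refl ⟩
  (∑[ i < r ] (disagree (s i) s i + disagree (s i) t i) + (disagree (s r) s r + disagree (s r) t r))
    + ∑[ j < r ] disagree (t j) t j
    ≡⟨ regroup (∑[ i < r ] (disagree (s i) s i + disagree (s i) t i)) _ (∑[ j < r ] disagree (t j) t j) ⟩
  (∑[ i < r ] (disagree (s i) s i + disagree (s i) t i) + ∑[ j < r ] disagree (t j) t j)
    + (disagree (s r) s r + disagree (s r) t r)
    ≡⟨ cong₂ _+_ (trans (sym (sumBelow-+ r _ _)) (cost-rows s t r))
                 (cong₂ _+_ (disagree-unprimed s t (s r) r) (disagree-primed s t (s r) r)) ⟩
  cost (rows s t r) + lastGain (s r) (tallyOf (rows s t r)) ∎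
  where
  regroup : ∀ a b c → a + b + c ≡ a + c + b
  regroup = solve-∀

-- Read in order, the rows of type S̄×S and S×S̄ drive a walk U − D by up-
-- and down-steps.  The numbers a and b bound how far it has risen above
-- and fallen below zero; a walk of U up- and D down-steps spans at most
-- max(U, D) levels in total.
record WalkBounds (U D a b : ℕ) : Set where
  field
    above : U ≤ D + a
    below : D ≤ U + b
    range : a + b ≤ U ⊔ D

walk-mirror : ∀ {U D a b} → WalkBounds U D a b → WalkBounds D U b a
walk-mirror {U} {D} {a} {b} w = record
  { above = below ; below = above ; range = subst₂ _≤_ (+-comm a b) (⊔-comm U D) range }
  where open WalkBounds w

walk-up : ∀ {U D a b} → WalkBounds U D a b → Σ ℕ λ a' → a ≤ a' × WalkBounds (suc U) D a' b
walk-up {U} {D} {a} {b} w with suc U ≤? D + a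
... | yes U<D+a = a , ≤-refl , record
  { above = U<D+a ; below = m≤n⇒m≤1+n below ; range = ≤-trans range (⊔-monoˡ-≤ D (n≤1+n U)) }
  where open WalkBounds w
... | no U≮D+a = suc a , n≤1+n a , record
  { above = ≤-reflexive (trans (cong suc U≡D+a) (sym (+-suc D a)))
  ; below = m≤n⇒m≤1+n below
  ; range = subst (suc (a + b) ≤_) (sym (m≥n⇒m⊔n≡m (m≤n⇒m≤1+n D≤U)))
              (s≤s (subst (a + b ≤_) (m≥n⇒m⊔n≡m D≤U) range)) }
  where
  open WalkBounds w
  U≡D+a : U ≡ D + a
  U≡D+a = ≤-antisym above (≤-pred (≰⇒> U≮D+a))
  D≤U : D ≤ U
  D≤U = subst (D ≤_) (sym U≡D+a) (m≤m+n D a)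

walk-down : ∀ {U D a b} → WalkBounds U D a b → Σ ℕ λ b' → b ≤ b' × WalkBounds U (suc D) a b'
walk-down w with walk-up (walk-mirror w)
... | b' , b≤b' , w' = b' , b≤b' , walk-mirror w'

basePotential : Tally → ℕ
basePotential (tally I O U D) =
  6 * I * O + U * U + D * D + 4 * U * D + 4 * I * U + 2 * O * U + 2 * I * D + 4 * O * D

potential : Tally → ℕ → ℕ → ℕ
potential T a b = basePotential T + 2 * (Tally.O T * a + Tally.I T * b)

potential-monoˡ : ∀ T {a a'} b → a ≤ a' → potential T a b ≤ potential T a' b
potential-monoˡ T@(tally I O U D) b a≤a' =
  +-monoʳ-≤ (basePotential T) (*-monoʳ-≤ 2 (+-monoˡ-≤ (I * b) (*-monoʳ-≤ O a≤a')))

potential-monoʳ : ∀ T a {b b'} → b ≤ b' → potential T a b ≤ potential T a b'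
potential-monoʳ T@(tally I O U D) a b≤b' =
  +-monoʳ-≤ (basePotential T) (*-monoʳ-≤ 2 (+-monoʳ-≤ (O * a) (*-monoʳ-≤ I b≤b')))

record Certificate (T : Tally) (c : ℕ) : Set where
  field
    a b   : ℕ
    walk  : WalkBounds (Tally.U T) (Tally.D T) a b
    bound : 2 * c + (Tally.U T + Tally.D T) ≤ potential T a b

charge : ∀ {c V P} g ΔV Δ {V' P'} → V' ≡ ΔV + V → P' ≡ Δ + P →
  2 * g + ΔV ≤ Δ → 2 * c + V ≤ P → 2 * (g + c) + V' ≤ P'
charge {c} {V} {P} g ΔV Δ refl refl paid old =
  subst (_≤ Δ + P) (sym (regroup g c ΔV V)) (+-mono-≤ paid old)
  where
  regroup : ∀ g c x y → 2 * (g + c) + (x + y) ≡ (2 * g + x) + (2 * c + y)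
  regroup = solve-∀

module RowIdentities where
  -- Doubled gains of the four row types (definitionally, gain ρ (tally I O U D)).
  gain-inside : ∀ O U D → 2 * (O + U + (O + D) + (O + D)) + 0 ≡ (6 * O + 2 * U + 2 * D) + 2 * D
  gain-inside = solve-∀
  gain-outside : ∀ I U D → 2 * (I + D + (I + U) + (I + U)) + 0 ≡ (6 * I + 2 * U + 2 * D) + 2 * U
  gain-outside = solve-∀
  gain-up : ∀ I O U D → 2 * (I + D + (I + U) + (O + D)) + 1 ≡ 4 * I + 2 * O + 2 * U + 4 * D + 1
  gain-up = solve-∀
  gain-down : ∀ I O U D → 2 * (O + U + (O + D) + (I + U)) + 1 ≡ 2 * I + 4 * O + 4 * U + 2 * D + 1
  gain-down = solve-∀

  potential-inside : ∀ I O U D a b →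
    6 * suc I * O + U * U + D * D + 4 * U * D + 4 * suc I * U + 2 * O * U + 2 * suc I * D + 4 * O * D + 2 * (O * a + suc I * b)
    ≡ ((6 * O + 2 * U + 2 * D) + 2 * (U + b))
      + (6 * I * O + U * U + D * D + 4 * U * D + 4 * I * U + 2 * O * U + 2 * I * D + 4 * O * D + 2 * (O * a + I * b))
  potential-inside = solve-∀
  potential-outside : ∀ I O U D a b →
    6 * I * suc O + U * U + D * D + 4 * U * D + 4 * I * U + 2 * suc O * U + 2 * I * D + 4 * suc O * D + 2 * (suc O * a + I * b)
    ≡ ((6 * I + 2 * U + 2 * D) + 2 * (D + a))
      + (6 * I * O + U * U + D * D + 4 * U * D + 4 * I * U + 2 * O * U + 2 * I * D + 4 * O * D + 2 * (O * a + I * b))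
  potential-outside = solve-∀
  potential-up : ∀ I O U D a b →
    6 * I * O + suc U * suc U + D * D + 4 * suc U * D + 4 * I * suc U + 2 * O * suc U + 2 * I * D + 4 * O * D + 2 * (O * a + I * b)
    ≡ (4 * I + 2 * O + 2 * U + 4 * D + 1)
      + (6 * I * O + U * U + D * D + 4 * U * D + 4 * I * U + 2 * O * U + 2 * I * D + 4 * O * D + 2 * (O * a + I * b))
  potential-up = solve-∀
  potential-down : ∀ I O U D a b →
    6 * I * O + U * U + suc D * suc D + 4 * U * suc D + 4 * I * U + 2 * O * U + 2 * I * suc D + 4 * O * suc D + 2 * (O * a + I * b)
    ≡ (2 * I + 4 * O + 4 * U + 2 * D + 1)
      + (6 * I * O + U * U + D * D + 4 * U * D + 4 * I * U + 2 * O * U + 2 * I * D + 4 * O * D + 2 * (O * a + I * b))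
  potential-down = solve-∀

-- Adding a row preserves the certificate: an S×S row is paid for since
-- D ≤ U + b, an S̄×S̄ row since U ≤ D + a, and mixed rows exactly, after
-- updating the walk bounds.
certificate-step : ∀ ρ T c → Certificate T c → Certificate (addRow ρ T) (gain ρ T + c)
certificate-step (true , true) (tally I O U D) c cert = record
  { a = a ; b = b ; walk = walk
  ; bound = charge (gain (true , true) (tally I O U D)) 0 _ refl (potential-inside I O U D a b)
      (≤-trans (≤-reflexive (gain-inside O U D)) (+-monoʳ-≤ (6 * O + 2 * U + 2 * D) (*-monoʳ-≤ 2 (WalkBounds.below walk)))) bound }
  where open Certificate cert ; open RowIdentities
certificate-step (false , false) (tally I O U D) c cert = record
  { a = a ; b = b ; walk = walk
  ; bound = charge (gain (false , false) (tally I O U D)) 0 _ refl (potential-outside I O U D a b)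
      (≤-trans (≤-reflexive (gain-outside I U D)) (+-monoʳ-≤ (6 * I + 2 * U + 2 * D) (*-monoʳ-≤ 2 (WalkBounds.above walk)))) bound }
  where open Certificate cert ; open RowIdentities
certificate-step (false , true) (tally I O U D) c cert with walk-up (Certificate.walk cert)
... | a' , a≤a' , walk' = record
  { a = a' ; b = b ; walk = walk'
  ; bound = charge (gain (false , true) (tally I O U D)) 1 _ refl (potential-up I O U D a' b)
      (≤-reflexive (gain-up I O U D)) (≤-trans bound (potential-monoˡ (tally I O U D) b a≤a')) }
  where open Certificate cert ; open RowIdentities
certificate-step (true , false) (tally I O U D) c cert with walk-down (Certificate.walk cert)
... | b' , b≤b' , walk' = record
  { a = a ; b = b' ; walk = walk'
  ; bound = charge (gain (true , false) (tally I O U D)) 1 _ (+-suc U D) (potential-down I O U D a b')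
      (≤-reflexive (gain-down I O U D)) (≤-trans bound (potential-monoʳ (tally I O U D) a b≤b')) }
  where open Certificate cert ; open RowIdentities

certificate : ∀ w → Certificate (tallyOf w) (cost w)
certificate []      = record
  { a = 0 ; b = 0 ; walk = record { above = z≤n ; below = z≤n ; range = z≤n } ; bound = z≤n }
certificate (ρ ∷ w) = certificate-step ρ (tallyOf w) (cost w) (certificate w)

-- The potential maximised over admissible walk bounds, in the variables
-- p = min(I, O), d = |I − O|, m = min(U, D), u = |U − D|.
reducedPotential : ℕ → ℕ → ℕ → ℕ → ℕ
reducedPotential p d m u =
  6 * p * p + u * u + 6 * m * m + 6 * d * p + 8 * d * m + 4 * d * u + 14 * m * p + 6 * m * u + 8 * p * u

heavier-weight : ∀ p d x y N → x + y ≤ N → (p + d) * x + p * y ≤ (p + d) * N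
heavier-weight p d x y N x+y≤N =
  ≤-trans (+-monoʳ-≤ ((p + d) * x) (*-monoˡ-≤ y (m≤m+n p d)))
    (subst (_≤ (p + d) * N) (*-distribˡ-+ (p + d) x y) (*-monoʳ-≤ (p + d) x+y≤N))

lighter-weight : ∀ p d x y m u → x + y ≤ m + u → y ≤ m → p * x + (p + d) * y ≤ p * (m + u) + d * m
lighter-weight p d x y m u x+y≤m+u y≤m =
  subst (_≤ p * (m + u) + d * m) (sym (split p d x y)) (+-mono-≤ (*-monoʳ-≤ p x+y≤m+u) (*-monoʳ-≤ d y≤m))
  where
  split : ∀ p d x y → p * x + (p + d) * y ≡ p * (x + y) + d * y
  split = solve-∀

record Reduced (T : Tally) (a b : ℕ) : Set where
  field
    p d m u    : ℕ
    size≡      : size T ≡ 2 * p + d + 2 * m + u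
    mixed≡     : Tally.U T + Tally.D T ≡ 2 * m + u
    larger≡    : Tally.I T ⊔ Tally.O T ≡ p + d
    potential≤ : potential T a b ≤ reducedPotential p d m u

module ReductionIdentities where
  size₁ : ∀ p d m u → p + (p + d) + (m + u) + m ≡ 2 * p + d + 2 * m + u
  size₁ = solve-∀
  size₂ : ∀ p d m u → p + d + p + (m + u) + m ≡ 2 * p + d + 2 * m + u
  size₂ = solve-∀
  size₃ : ∀ p d m u → p + d + p + m + (m + u) ≡ 2 * p + d + 2 * m + u
  size₃ = solve-∀
  size₄ : ∀ p d m u → p + (p + d) + m + (m + u) ≡ 2 * p + d + 2 * m + u
  size₄ = solve-∀
  mixed₁ : ∀ m u → m + u + m ≡ 2 * m + u
  mixed₁ = solve-∀
  mixed₂ : ∀ m u → m + (m + u) ≡ 2 * m + u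
  mixed₂ = solve-∀
  base₁ : ∀ p d m u →
    6 * p * (p + d) + (m + u) * (m + u) + m * m + 4 * (m + u) * m + 4 * p * (m + u) + 2 * (p + d) * (m + u)
      + 2 * p * m + 4 * (p + d) * m + 2 * ((p + d) * (m + u))
    ≡ 6 * p * p + u * u + 6 * m * m + 6 * d * p + 8 * d * m + 4 * d * u + 14 * m * p + 6 * m * u + 8 * p * u
  base₁ = solve-∀
  base₂ : ∀ p d m u →
    6 * (p + d) * p + (m + u) * (m + u) + m * m + 4 * (m + u) * m + 4 * (p + d) * (m + u) + 2 * p * (m + u)
      + 2 * (p + d) * m + 4 * p * m + 2 * (p * (m + u) + d * m)
    ≡ 6 * p * p + u * u + 6 * m * m + 6 * d * p + 8 * d * m + 4 * d * u + 14 * m * p + 6 * m * u + 8 * p * u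
  base₂ = solve-∀
  base₃ : ∀ p d m u →
    6 * (p + d) * p + m * m + (m + u) * (m + u) + 4 * m * (m + u) + 4 * (p + d) * m + 2 * p * m
      + 2 * (p + d) * (m + u) + 4 * p * (m + u) + 2 * ((p + d) * (m + u))
    ≡ 6 * p * p + u * u + 6 * m * m + 6 * d * p + 8 * d * m + 4 * d * u + 14 * m * p + 6 * m * u + 8 * p * u
  base₃ = solve-∀
  base₄ : ∀ p d m u →
    6 * p * (p + d) + m * m + (m + u) * (m + u) + 4 * m * (m + u) + 4 * p * m + 2 * (p + d) * m
      + 2 * p * (m + u) + 4 * (p + d) * (m + u) + 2 * (p * (m + u) + d * m)
    ≡ 6 * p * p + u * u + 6 * m * m + 6 * d * p + 8 * d * m + 4 * d * u + 14 * m * p + 6 * m * u + 8 * p * u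
  base₄ = solve-∀

-- When D ≤ U, say U = m + u and D = m, the budget satisfies a + b ≤ m + u
-- and b ≤ m (the walk must first come back from height u ≤ a).
budget : ∀ {m u a b} → WalkBounds (m + u) m a b → a + b ≤ m + u × b ≤ m
budget {m} {u} {a} {b} walk =
  a+b≤m+u , +-cancelʳ-≤ u b m (≤-trans (subst (_≤ a + b) (+-comm u b) (+-monoˡ-≤ b u≤a)) a+b≤m+u)
  where
  open WalkBounds walk
  a+b≤m+u : a + b ≤ m + u
  a+b≤m+u = subst (a + b ≤_) (m≥n⇒m⊔n≡m (m≤m+n m u)) range
  u≤a : u ≤ a
  u≤a = +-cancelˡ-≤ m u a above

-- Split by the orders of I, O and of U, D; the walk bounds confine the
-- budget 2 (O a + I b) exactly as reducedPotential assumes.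
reduce : ∀ T a b → WalkBounds (Tally.U T) (Tally.D T) a b → Reduced T a b
reduce (tally I O U D) a b walk with ≤-total I O | ≤-total D U
... | inj₁ I≤O | inj₁ D≤U with O ∸ I | m+[n∸m]≡n I≤O | U ∸ D | m+[n∸m]≡n D≤U
...   | d | refl | u | refl = record
  { p = I ; d = d ; m = D ; u = u
  ; size≡ = size₁ I d D u ; mixed≡ = mixed₁ D u ; larger≡ = m≤n⇒m⊔n≡n I≤O
  ; potential≤ = ≤-trans (+-monoʳ-≤ (basePotential (tally I (I + d) (D + u) D)) (*-monoʳ-≤ 2
      (heavier-weight I d a b (D + u) (proj₁ (budget walk)))))
      (≤-reflexive (base₁ I d D u)) }
  where open ReductionIdentities
reduce (tally I O U D) a b walk | inj₂ O≤I | inj₁ D≤U with I ∸ O | m+[n∸m]≡n O≤I | U ∸ D | m+[n∸m]≡n D≤U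
...   | d | refl | u | refl = record
  { p = O ; d = d ; m = D ; u = u
  ; size≡ = size₂ O d D u ; mixed≡ = mixed₁ D u ; larger≡ = m≥n⇒m⊔n≡m O≤I
  ; potential≤ = ≤-trans (+-monoʳ-≤ (basePotential (tally (O + d) O (D + u) D)) (*-monoʳ-≤ 2
      (lighter-weight O d a b D u (proj₁ (budget walk)) (proj₂ (budget walk)))))
      (≤-reflexive (base₂ O d D u)) }
  where open ReductionIdentities
reduce (tally I O U D) a b walk | inj₂ O≤I | inj₂ U≤D with I ∸ O | m+[n∸m]≡n O≤I | D ∸ U | m+[n∸m]≡n U≤D
...   | d | refl | u | refl = record
  { p = O ; d = d ; m = U ; u = u
  ; size≡ = size₃ O d U u ; mixed≡ = mixed₂ U u ; larger≡ = m≥n⇒m⊔n≡m O≤I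
  ; potential≤ = ≤-trans (+-monoʳ-≤ (basePotential (tally (O + d) O U (U + u))) (*-monoʳ-≤ 2
      (subst (_≤ (O + d) * (U + u)) (+-comm ((O + d) * b) (O * a))
        (heavier-weight O d b a (U + u) (proj₁ (budget (walk-mirror walk)))))))
      (≤-reflexive (base₃ O d U u)) }
  where open ReductionIdentities
reduce (tally I O U D) a b walk | inj₁ I≤O | inj₂ U≤D with O ∸ I | m+[n∸m]≡n I≤O | D ∸ U | m+[n∸m]≡n U≤D
...   | d | refl | u | refl = record
  { p = I ; d = d ; m = U ; u = u
  ; size≡ = size₄ I d U u ; mixed≡ = mixed₂ U u ; larger≡ = m≤n⇒m⊔n≡n I≤O
  ; potential≤ = ≤-trans (+-monoʳ-≤ (basePotential (tally I (I + d) U (U + u))) (*-monoʳ-≤ 2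
      (subst (_≤ I * (U + u) + d * U) (+-comm (I * b) ((I + d) * a))
        (lighter-weight I d b a U u (proj₁ (budget (walk-mirror walk))) (proj₂ (budget (walk-mirror walk)))))))
      (≤-reflexive (base₄ I d U u)) }
  where open ReductionIdentities

two-products-ordered : ∀ {x y} → x ≤ y → 2 * x * y ≤ x * x + y * y
two-products-ordered {x} {y} x≤y = subst (λ z → 2 * x * z ≤ x * x + z * z) (m+[n∸m]≡n x≤y) (gap x (y ∸ x))
  where
  gap : ∀ x e → 2 * x * (x + e) ≤ x * x + (x + e) * (x + e)
  gap x e = subst (2 * x * (x + e) ≤_) (sym (square x e)) (m≤m+n _ _)
    where
    square : ∀ x e → x * x + (x + e) * (x + e) ≡ 2 * x * (x + e) + e * e
    square = solve-∀

two-products : ∀ x y → 2 * x * y ≤ x * x + y * y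
two-products x y with ≤-total x y
... | inj₁ x≤y = two-products-ordered x≤y
... | inj₂ y≤x = subst₂ _≤_ (swap y x) (+-comm (y * y) (x * x)) (two-products-ordered y≤x)
  where
  swap : ∀ y x → 2 * y * x ≡ 2 * x * y
  swap = solve-∀

sum-of-squares : ∀ A B c x₁ y₁ x₂ y₂ →
  B + (2 * x₁ * y₁ + 2 * x₂ * y₂) ≡ A + c + (x₁ * x₁ + y₁ * y₁ + (x₂ * x₂ + y₂ * y₂)) → A ≤ B
sum-of-squares A B c x₁ y₁ x₂ y₂ eq = ≤-trans (m≤m+n A c) (+-cancelʳ-≤ _ (A + c) B
  (≤-trans (+-monoʳ-≤ (A + c) (+-mono-≤ (two-products x₁ y₁) (two-products x₂ y₂))) (≤-reflexive (sym eq))))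

-- The two polynomial inequalities behind the bounds, n = 2p + d + 2m + u:
--   6 H + 2n ≤ 10n² + 3 + 6(2m + u),
--   6 H + 24(p + d) + 6(2m + u) ≤ 10n² + 10n + 11,
-- where H = reducedPotential p d m u; the gaps are
-- (2p + d − 2u − m − 1)² + (3d − m)² + 2m² + 6m + 2 and
-- (2p + d − 2u − m − 1)² + (3d − m − 2)² + 2m² + 2m + 6.
core-full : ∀ p d m u →
  6 * reducedPotential p d m u + 2 * (2 * p + d + 2 * m + u)
    ≤ 10 * ((2 * p + d + 2 * m + u) * (2 * p + d + 2 * m + u)) + 3 + 6 * (2 * m + u)
core-full p d m u =
  sum-of-squares _ _ (2 * m * m + 6 * m + 2) (2 * p + d) (2 * u + m + 1) (3 * d) m (squares p d m u)
  where
  squares : ∀ p d m u →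
    10 * ((2 * p + d + 2 * m + u) * (2 * p + d + 2 * m + u)) + 3 + 6 * (2 * m + u)
      + (2 * (2 * p + d) * (2 * u + m + 1) + 2 * (3 * d) * m)
    ≡ 6 * (6 * p * p + u * u + 6 * m * m + 6 * d * p + 8 * d * m + 4 * d * u + 14 * m * p + 6 * m * u + 8 * p * u)
      + 2 * (2 * p + d + 2 * m + u) + (2 * m * m + 6 * m + 2)
      + ((2 * p + d) * (2 * p + d) + (2 * u + m + 1) * (2 * u + m + 1) + ((3 * d) * (3 * d) + m * m))
  squares = solve-∀

core-minus : ∀ p d m u →
  6 * reducedPotential p d m u + 24 * (p + d) + 6 * (2 * m + u)
    ≤ 10 * ((2 * p + d + 2 * m + u) * (2 * p + d + 2 * m + u)) + 10 * (2 * p + d + 2 * m + u) + 11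
core-minus p d m u =
  sum-of-squares _ _ (2 * m * m + 2 * m + 6) (2 * p + d) (2 * u + m + 1) (3 * d) (m + 2) (squares p d m u)
  where
  squares : ∀ p d m u →
    10 * ((2 * p + d + 2 * m + u) * (2 * p + d + 2 * m + u)) + 10 * (2 * p + d + 2 * m + u) + 11
      + (2 * (2 * p + d) * (2 * u + m + 1) + 2 * (3 * d) * (m + 2))
    ≡ 6 * (6 * p * p + u * u + 6 * m * m + 6 * d * p + 8 * d * m + 4 * d * u + 14 * m * p + 6 * m * u + 8 * p * u)
      + 24 * (p + d) + 6 * (2 * m + u) + (2 * m * m + 2 * m + 6)
      + ((2 * p + d) * (2 * p + d) + (2 * u + m + 1) * (2 * u + m + 1) + ((3 * d) * (3 * d) + (m + 2) * (m + 2)))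
  squares = solve-∀

lastGain≤ : ∀ σ T → lastGain σ T ≤ 2 * (Tally.I T ⊔ Tally.O T) + (Tally.U T + Tally.D T)
lastGain≤ true  (tally I O U D) =
  subst (_≤ 2 * (I ⊔ O) + (U + D)) (sym (regroup O U D)) (+-monoˡ-≤ (U + D) (*-monoʳ-≤ 2 (m≤n⊔m I O)))
  where
  regroup : ∀ O U D → O + U + (O + D) ≡ 2 * O + (U + D)
  regroup = solve-∀
lastGain≤ false (tally I O U D) =
  subst (_≤ 2 * (I ⊔ O) + (U + D)) (sym (regroup I U D)) (+-monoˡ-≤ (U + D) (*-monoʳ-≤ 2 (m≤m⊔n I O)))
  where
  regroup : ∀ I U D → I + D + (I + U) ≡ 2 * I + (U + D)
  regroup = solve-∀

full-from-core : ∀ {c V H n} → 2 * c + V ≤ H → 6 * H + 2 * n ≤ 10 * (n * n) + 3 + 6 * V →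
  12 * c + 2 * n ≤ 10 * (n * n) + 3
full-from-core {c} {V} {H} {n} bound core = +-cancelʳ-≤ (6 * V) (12 * c + 2 * n) _
  (≤-trans (≤-reflexive (regroup c n V)) (≤-trans (+-monoˡ-≤ (2 * n) (*-monoʳ-≤ 6 bound)) core))
  where
  regroup : ∀ c n V → 12 * c + 2 * n + 6 * V ≡ 6 * (2 * c + V) + 2 * n
  regroup = solve-∀

minus-from-core : ∀ {c g V H q B} → 2 * c + V ≤ H → g ≤ 2 * q + V → 6 * H + 24 * q + 6 * V ≤ B →
  12 * (c + g) ≤ B
minus-from-core {c} {g} {V} {H} {q} bound g≤ core =
  ≤-trans (*-monoʳ-≤ 12 (+-monoʳ-≤ c g≤))
    (≤-trans (≤-reflexive (regroup c q V)) (≤-trans (+-monoˡ-≤ (6 * V) (+-monoˡ-≤ (24 * q) (*-monoʳ-≤ 6 bound))) core))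
  where
  regroup : ∀ c q V → 12 * (c + (2 * q + V)) ≡ 6 * (2 * c + V) + 24 * q + 6 * V
  regroup = solve-∀

fullBound : ∀ {T c} → Certificate T c → 12 * c + 2 * size T ≤ 10 * (size T * size T) + 3
fullBound {T} {c} cert =
  subst (λ n → 12 * c + 2 * n ≤ 10 * (n * n) + 3) (sym size≡)
    (full-from-core {c} {2 * m + u} {reducedPotential p d m u} {2 * p + d + 2 * m + u} (subst (λ V → 2 * c + V ≤ reducedPotential p d m u) mixed≡ (≤-trans bound potential≤))
                    (core-full p d m u))
  where
  open Certificate cert
  open Reduced (reduce T a b walk)

minusBound : ∀ {T c} → Certificate T c → ∀ σ → 12 * (c + lastGain σ T) ≤ 10 * (size T * size T) + 10 * size T + 11
minusBound {T} {c} cert σ =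
  subst (λ n → 12 * (c + lastGain σ T) ≤ 10 * (n * n) + 10 * n + 11) (sym size≡)
    (minus-from-core {c} {lastGain σ T} {2 * m + u} {reducedPotential p d m u} {p + d} (subst (λ V → 2 * c + V ≤ reducedPotential p d m u) mixed≡ (≤-trans bound potential≤))
                     (subst₂ (λ q V → lastGain σ T ≤ 2 * q + V) larger≡ mixed≡ (lastGain≤ σ T))
                     (core-minus p d m u))
  where
  open Certificate cert
  open Reduced (reduce T a b walk)

-- Twelve times the maximum cut size lies in [maxCutBound − 11, maxCutBound].
maxCutBound : Variant → ℕ → ℕ
maxCutBound full  k = 10 * (k * k) + 18 * k + 11
maxCutBound minus k = 10 * (k * k) + 10 * k + 11

cut-upper : ∀ k g (S : Cut k (primes g k)) → 12 * cs S ≤ maxCutBound g k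
cut-upper k full S =
  +-cancelʳ-≤ (2 * suc k) (12 * cs S) (maxCutBound full k) (≤-trans bound (≤-reflexive (expand k)))
  where
  s = unprimedSides S
  t = primedSides S
  bound : 12 * cs S + 2 * suc k ≤ 10 * (suc k * suc k) + 3
  bound = subst₂ (λ c n → 12 * c + 2 * n ≤ 10 * (n * n) + 3)
    (sym (trans (cs-cutCount S s t (describe S)) (cutCount-full s t (suc k)))) (size-rows s t (suc k))
    (fullBound (certificate (rows s t (suc k))))
  expand : ∀ k → 10 * (suc k * suc k) + 3 ≡ 10 * (k * k) + 18 * k + 11 + 2 * suc k
  expand = solve-∀
cut-upper k minus S =
  subst₂ (λ c n → 12 * c ≤ 10 * (n * n) + 10 * n + 11)
    (sym (trans (cs-cutCount S s t (describe S)) (cutCount-minus s t k))) (size-rows s t k)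
    (minusBound (certificate (rows s t k)) (s k))
  where
  s = unprimedSides S
  t = primedSides S

patternCut : ∀ {k m} → ℕ → ℕ → Cut k m
patternCut x y (v i)  = toℕ i <ᵇ x
patternCut x y (v' j) = toℕ j <ᵇ x + y

rowPattern : ∀ {k m} x y → RowPattern (patternCut {k} {m} x y) x y
rowPattern x y i j i≡j =
  (λ j<x → trans (cong (_<ᵇ x) i≡j) (<ᵇ-true j<x) , <ᵇ-true (≤-trans j<x (m≤m+n x y))) ,
  (λ x≤j j<x+y → trans (cong (_<ᵇ x) i≡j) (<ᵇ-false x≤j) , <ᵇ-true j<x+y) ,
  (λ x+y≤j → trans (cong (_<ᵇ x) i≡j) (<ᵇ-false (≤-trans (m≤m+n x y) x+y≤j)) , <ᵇ-false x+y≤j)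

inside up outside : Row
inside  = true , true
up      = false , true
outside = false , false

blockRows : ℕ → ℕ → ℕ → List Row
blockRows x y z = replicate z outside ++ replicate y up ++ replicate x inside

rows-constant : ∀ s t a d ρ → (∀ q → q < d → (s (a + q) , t (a + q)) ≡ ρ) →
  rows s t (a + d) ≡ replicate d ρ ++ rows s t a
rows-constant s t a zero    ρ same = cong (rows s t) (+-identityʳ a)
rows-constant s t a (suc d) ρ same = begin
  rows s t (a + suc d)                        ≡⟨ cong (rows s t) (+-suc a d) ⟩
  (s (a + d) , t (a + d)) ∷ rows s t (a + d)  ≡⟨ cong₂ _∷_ (same d ≤-refl)
                                                   (rows-constant s t a d ρ (λ q q<d → same q (m<n⇒m<1+n q<d))) ⟩
  ρ ∷ replicate d ρ ++ rows s t a             ∎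

rows-pattern : ∀ x y z → rows (_<ᵇ x) (_<ᵇ x + y) (x + y + z) ≡ blockRows x y z
rows-pattern x y z = begin
  rows s t (x + y + z)
    ≡⟨ rows-constant s t (x + y) z outside (λ q _ →
         cong₂ _,_ (<ᵇ-false (≤-trans (m≤m+n x y) (m≤m+n (x + y) q))) (<ᵇ-false (m≤m+n (x + y) q))) ⟩
  replicate z outside ++ rows s t (x + y)
    ≡⟨ cong (replicate z outside ++_) (rows-constant s t x y up (λ q q<y →
         cong₂ _,_ (<ᵇ-false (m≤m+n x q)) (<ᵇ-true (+-monoʳ-< x q<y)))) ⟩
  replicate z outside ++ replicate y up ++ rows s t x
    ≡⟨ cong (λ w → replicate z outside ++ replicate y up ++ w)
         (trans (rows-constant s t 0 x inside (λ q q<x → cong₂ _,_ (<ᵇ-true q<x) (<ᵇ-true (≤-trans q<x (m≤m+n x y)))))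
                (++-identityʳ (replicate x inside))) ⟩
  blockRows x y z ∎
  where
  s = _<ᵇ x
  t = _<ᵇ x + y

insideBlock : ∀ x → tallyOf (replicate x inside) ≡ tally x 0 0 0 × cost (replicate x inside) ≡ 0
insideBlock zero = refl , refl
insideBlock (suc x) rewrite proj₁ (insideBlock x) | proj₂ (insideBlock x) = refl , refl

-- Each S̄×S row meets the S×S block twice and the earlier S̄×S rows once.
upBlock : ∀ x y → tallyOf (replicate y up ++ replicate x inside) ≡ tally x 0 y 0
                × 2 * cost (replicate y up ++ replicate x inside) + y ≡ 4 * x * y + y * y
upBlock x zero rewrite proj₁ (insideBlock x) | proj₂ (insideBlock x) = refl , sym (vanish x)
  where
  vanish : ∀ x → 4 * x * 0 + 0 * 0 ≡ 0
  vanish = solve-∀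
upBlock x (suc y) rewrite proj₁ (upBlock x y) = refl , (begin
  2 * (x + 0 + (x + y) + (0 + 0) + c) + suc y  ≡⟨ before x y c ⟩
  (2 * c + y) + (4 * x + 2 * y + 1)            ≡⟨ cong (_+ (4 * x + 2 * y + 1)) (proj₂ (upBlock x y)) ⟩
  (4 * x * y + y * y) + (4 * x + 2 * y + 1)    ≡⟨ after x y ⟩
  4 * x * suc y + suc y * suc y                ∎)
  where
  c = cost (replicate y up ++ replicate x inside)
  before : ∀ x y c → 2 * (x + 0 + (x + y) + (0 + 0) + c) + suc y ≡ (2 * c + y) + (4 * x + 2 * y + 1)
  before = solve-∀
  after : ∀ x y → (4 * x * y + y * y) + (4 * x + 2 * y + 1) ≡ 4 * x * suc y + suc y * suc y
  after = solve-∀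

-- Each S̄×S̄ row meets the S×S block three times and the S̄×S block twice.
outsideBlock : ∀ x y z w → tallyOf w ≡ tally x 0 y 0 →
  tallyOf (replicate z outside ++ w) ≡ tally x z y 0 × cost (replicate z outside ++ w) ≡ z * (3 * x + 2 * y) + cost w
outsideBlock x y zero    w T≡ = T≡ , refl
outsideBlock x y (suc z) w T≡ rewrite proj₁ (outsideBlock x y z w T≡) =
  refl , trans (cong (x + 0 + (x + y) + (x + y) +_) (proj₂ (outsideBlock x y z w T≡))) (collect x y z (cost w))
  where
  collect : ∀ x y z c → x + 0 + (x + y) + (x + y) + (z * (3 * x + 2 * y) + c) ≡ suc z * (3 * x + 2 * y) + c
  collect = solve-∀

-- Twice the cut size of the pattern, plus y.
twiceBlockCost : ℕ → ℕ → ℕ → ℕ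
twiceBlockCost x y z = 2 * (z * (3 * x + 2 * y)) + (4 * x * y + y * y)

blockRows-cost : ∀ x y z → tallyOf (blockRows x y z) ≡ tally x z y 0 × 2 * cost (blockRows x y z) + y ≡ twiceBlockCost x y z
blockRows-cost x y z =
  proj₁ outside-part ,
  trans (cong (λ c → 2 * c + y) (proj₂ outside-part))
        (trans (regroup (z * (3 * x + 2 * y)) (cost (replicate y up ++ replicate x inside)) y)
               (cong (2 * (z * (3 * x + 2 * y)) +_) (proj₂ (upBlock x y))))
  where
  outside-part = outsideBlock x y z (replicate y up ++ replicate x inside) (proj₁ (upBlock x y))
  regroup : ∀ a c y → 2 * (a + c) + y ≡ 2 * a + (2 * c + y)
  regroup = solve-∀

-- Twelve times the pattern's cut size, plus 6y.
patternBound : Variant → ℕ → ℕ → ℕ → ℕ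
patternBound full  x y z = 6 * twiceBlockCost x y z
patternBound minus x y z = 6 * twiceBlockCost x y z + 12 * (2 * x + y)

pattern-value : ∀ k g x y z → x + y + z ≡ primes g k →
  12 * cs (patternCut {k} {primes g k} x y) + 6 * y ≡ patternBound g x y z
pattern-value k full x y z rows≡ = begin
  12 * cs (patternCut {k} {suc k} x y) + 6 * y  ≡⟨ cong (λ c → 12 * c + 6 * y) cs≡ ⟩
  12 * cost (blockRows x y z) + 6 * y          ≡⟨ six (cost (blockRows x y z)) y ⟩
  6 * (2 * cost (blockRows x y z) + y)         ≡⟨ cong (6 *_) (proj₂ (blockRows-cost x y z)) ⟩
  6 * twiceBlockCost x y z                     ∎
  where
  cs≡ : cs (patternCut {k} {suc k} x y) ≡ cost (blockRows x y z)
  cs≡ = trans (cs-cutCount (patternCut {k} {suc k} x y) (_<ᵇ x) (_<ᵇ x + y) ((λ _ → refl) , (λ _ → refl)))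
       (trans (cutCount-full (_<ᵇ x) (_<ᵇ x + y) (suc k))
       (trans (cong (cost ∘ rows (_<ᵇ x) (_<ᵇ x + y)) (sym rows≡)) (cong cost (rows-pattern x y z))))
  six : ∀ c y → 12 * c + 6 * y ≡ 6 * (2 * c + y)
  six = solve-∀
pattern-value .(x + y + z) minus x y z refl = begin
  12 * cs (patternCut {x + y + z} x y) + 6 * y                  ≡⟨ cong (λ c → 12 * c + 6 * y) cs≡ ⟩
  12 * (cost (blockRows x y z) + (x + 0 + (x + y))) + 6 * y     ≡⟨ six (cost (blockRows x y z)) x y ⟩
  6 * (2 * cost (blockRows x y z) + y) + 12 * (2 * x + y)       ≡⟨ cong (λ c → 6 * c + 12 * (2 * x + y)) (proj₂ (blockRows-cost x y z)) ⟩
  6 * twiceBlockCost x y z + 12 * (2 * x + y)                   ∎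
  where
  s = _<ᵇ x
  t = _<ᵇ x + y
  cs≡ : cs (patternCut {x + y + z} x y) ≡ cost (blockRows x y z) + (x + 0 + (x + y))
  cs≡ = trans (cs-cutCount (patternCut {x + y + z} {x + y + z} x y) s t ((λ _ → refl) , (λ _ → refl)))
       (trans (cutCount-minus s t (x + y + z))
       (trans (cong₂ (λ w b → cost w + lastGain b (tallyOf w)) (rows-pattern x y z)
                     (<ᵇ-false (≤-trans (m≤m+n x y) (m≤m+n (x + y) z))))
              (cong (λ T → cost (blockRows x y z) + lastGain false T) (proj₁ (blockRows-cost x y z)))))
  six : ∀ c x y → 12 * (c + (x + 0 + (x + y))) + 6 * y ≡ 6 * (2 * c + y) + 12 * (2 * x + y)
  six = solve-∀

nearThird : ∀ j d e → d ≤ 2 → e ≤ 1 → NearThird (j + e) (d + j * 3)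
nearThird j d e d≤2 e≤1 =
  ≤-trans (≤-reflexive (spread j e)) (≤-trans (+-monoʳ-≤ (j * 3) (*-monoʳ-≤ 3 e≤1)) (+-monoˡ-≤ 3 (m≤n+m (j * 3) d))) ,
  ≤-trans (+-monoˡ-≤ (j * 3) (≤-trans d≤2 (n≤1+n 2))) (≤-trans (m≤m+n (3 + j * 3) (3 * e)) (≤-reflexive (spread′ j e)))
  where
  spread : ∀ j e → 3 * (j + e) ≡ j * 3 + 3 * e
  spread = solve-∀
  spread′ : ∀ j e → 3 + j * 3 + 3 * e ≡ 3 * (j + e) + 3
  spread′ = solve-∀

record OptimalBlocks (g : Variant) (k : ℕ) : Set where
  field
    x y z  : ℕ
    rows≡  : x + y + z ≡ primes g k
    near-x : NearThird x k
    near-y : NearThird y k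
    near-z : NearThird z k
    tight  : maxCutBound g k + 6 * y ≤ patternBound g x y z + 11

-- The choices of (x, y, z) for k = 3j, 3j + 1, 3j + 2; maxCutBound exceeds
-- 12·cs of the pattern by 11, 3, 3 for CC_k and by 11, 7, 11 for CC_k^-.
byResidue : ∀ j (r : Fin 3) g → OptimalBlocks g (toℕ r + j * 3)
byResidue j zero full = record
  { x = j + 0 ; y = j + 0 ; z = j + 1 ; rows≡ = lengths j
  ; near-x = nearThird j 0 0 z≤n z≤n ; near-y = nearThird j 0 0 z≤n z≤n ; near-z = nearThird j 0 1 z≤n ≤-refl
  ; tight = ≤-reflexive (value j) }
  where
  lengths : ∀ j → j + 0 + (j + 0) + (j + 1) ≡ suc (j * 3)
  lengths = solve-∀
  value : ∀ j → 10 * (j * 3 * (j * 3)) + 18 * (j * 3) + 11 + 6 * (j + 0)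
              ≡ 6 * (2 * ((j + 1) * (3 * (j + 0) + 2 * (j + 0))) + (4 * (j + 0) * (j + 0) + (j + 0) * (j + 0))) + 11
  value = solve-∀
byResidue j (suc zero) full = record
  { x = j + 1 ; y = j + 0 ; z = j + 1 ; rows≡ = lengths j
  ; near-x = nearThird j 1 1 (s≤s z≤n) ≤-refl ; near-y = nearThird j 1 0 (s≤s z≤n) z≤n ; near-z = nearThird j 1 1 (s≤s z≤n) ≤-refl
  ; tight = ≤-trans (m≤m+n _ 8) (≤-reflexive (value j)) }
  where
  lengths : ∀ j → j + 1 + (j + 0) + (j + 1) ≡ suc (1 + j * 3)
  lengths = solve-∀
  value : ∀ j → 10 * ((1 + j * 3) * (1 + j * 3)) + 18 * (1 + j * 3) + 11 + 6 * (j + 0) + 8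
              ≡ 6 * (2 * ((j + 1) * (3 * (j + 1) + 2 * (j + 0))) + (4 * (j + 1) * (j + 0) + (j + 0) * (j + 0))) + 11
  value = solve-∀
byResidue j (suc (suc zero)) full = record
  { x = j + 1 ; y = j + 1 ; z = j + 1 ; rows≡ = lengths j
  ; near-x = nearThird j 2 1 ≤-refl ≤-refl ; near-y = nearThird j 2 1 ≤-refl ≤-refl ; near-z = nearThird j 2 1 ≤-refl ≤-refl
  ; tight = ≤-trans (m≤m+n _ 8) (≤-reflexive (value j)) }
  where
  lengths : ∀ j → j + 1 + (j + 1) + (j + 1) ≡ suc (2 + j * 3)
  lengths = solve-∀
  value : ∀ j → 10 * ((2 + j * 3) * (2 + j * 3)) + 18 * (2 + j * 3) + 11 + 6 * (j + 1) + 8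
              ≡ 6 * (2 * ((j + 1) * (3 * (j + 1) + 2 * (j + 1))) + (4 * (j + 1) * (j + 1) + (j + 1) * (j + 1))) + 11
  value = solve-∀
byResidue j zero minus = record
  { x = j + 0 ; y = j + 0 ; z = j + 0 ; rows≡ = lengths j
  ; near-x = nearThird j 0 0 z≤n z≤n ; near-y = nearThird j 0 0 z≤n z≤n ; near-z = nearThird j 0 0 z≤n z≤n
  ; tight = ≤-reflexive (value j) }
  where
  lengths : ∀ j → j + 0 + (j + 0) + (j + 0) ≡ j * 3
  lengths = solve-∀
  value : ∀ j → 10 * (j * 3 * (j * 3)) + 10 * (j * 3) + 11 + 6 * (j + 0)
              ≡ 6 * (2 * ((j + 0) * (3 * (j + 0) + 2 * (j + 0))) + (4 * (j + 0) * (j + 0) + (j + 0) * (j + 0)))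
                + 12 * (2 * (j + 0) + (j + 0)) + 11
  value = solve-∀
byResidue j (suc zero) minus = record
  { x = j + 1 ; y = j + 0 ; z = j + 0 ; rows≡ = lengths j
  ; near-x = nearThird j 1 1 (s≤s z≤n) ≤-refl ; near-y = nearThird j 1 0 (s≤s z≤n) z≤n ; near-z = nearThird j 1 0 (s≤s z≤n) z≤n
  ; tight = ≤-trans (m≤m+n _ 4) (≤-reflexive (value j)) }
  where
  lengths : ∀ j → j + 1 + (j + 0) + (j + 0) ≡ 1 + j * 3
  lengths = solve-∀
  value : ∀ j → 10 * ((1 + j * 3) * (1 + j * 3)) + 10 * (1 + j * 3) + 11 + 6 * (j + 0) + 4
              ≡ 6 * (2 * ((j + 0) * (3 * (j + 1) + 2 * (j + 0))) + (4 * (j + 1) * (j + 0) + (j + 0) * (j + 0)))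
                + 12 * (2 * (j + 1) + (j + 0)) + 11
  value = solve-∀
byResidue j (suc (suc zero)) minus = record
  { x = j + 1 ; y = j + 0 ; z = j + 1 ; rows≡ = lengths j
  ; near-x = nearThird j 2 1 ≤-refl ≤-refl ; near-y = nearThird j 2 0 ≤-refl z≤n ; near-z = nearThird j 2 1 ≤-refl ≤-refl
  ; tight = ≤-reflexive (value j) }
  where
  lengths : ∀ j → j + 1 + (j + 0) + (j + 1) ≡ 2 + j * 3
  lengths = solve-∀
  value : ∀ j → 10 * ((2 + j * 3) * (2 + j * 3)) + 10 * (2 + j * 3) + 11 + 6 * (j + 0)
              ≡ 6 * (2 * ((j + 1) * (3 * (j + 1) + 2 * (j + 0))) + (4 * (j + 1) * (j + 0) + (j + 0) * (j + 0)))
                + 12 * (2 * (j + 1) + (j + 0)) + 11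
  value = solve-∀

optimalBlocks : ∀ k g → OptimalBlocks g k
optimalBlocks k g with k divMod 3
... | result j r refl = byResidue j r g

twelve-squeeze : ∀ {a b B} → 12 * a ≤ B → B ≤ 12 * b + 11 → a ≤ b
twelve-squeeze {a} {b} a≤B B≤b =
  ≤-pred (*-cancelˡ-< 12 a (suc b) (≤-trans (s≤s (≤-trans a≤B B≤b)) (≤-reflexive (round-up b))))
  where
  round-up : ∀ b → suc (12 * b + 11) ≡ 12 * suc b
  round-up = solve-∀

optimal-lower : ∀ k g → let open OptimalBlocks (optimalBlocks k g) in
  maxCutBound g k ≤ 12 * cs (patternCut {k} {primes g k} x y) + 11
optimal-lower k g = +-cancelʳ-≤ (6 * y) (maxCutBound g k) _
  (≤-trans tight (≤-reflexive (trans (cong (_+ 11) (sym (pattern-value k g x y z rows≡))) (regroup (12 * cs (patternCut {k} {primes g k} x y)) (6 * y)))))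
  where
  open OptimalBlocks (optimalBlocks k g)
  regroup : ∀ a b → a + b + 11 ≡ a + 11 + b
  regroup = solve-∀

bound-above : ∀ g k → 1 ≤ k → maxCutBound g k ≤ 2 * (5 * (k * k) + 6 * 3 * k)
bound-above g k 1≤k = ≤-trans (at-most-full g) (≤-trans (+-monoʳ-≤ (10 * (k * k) + 18 * k) eleven) (≤-reflexive (double k)))
  where
  at-most-full : ∀ g → maxCutBound g k ≤ 10 * (k * k) + 18 * k + 11
  at-most-full full  = ≤-refl
  at-most-full minus = +-monoˡ-≤ 11 (+-monoʳ-≤ (10 * (k * k)) (*-monoˡ-≤ k (≤ᵇ⇒≤ 10 18 _)))
  eleven : 11 ≤ 18 * k
  eleven = ≤-trans (≤ᵇ⇒≤ 11 18 _) (*-monoʳ-≤ 18 1≤k)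
  double : ∀ k → 10 * (k * k) + 18 * k + 18 * k ≡ 2 * (5 * (k * k) + 6 * 3 * k)
  double = solve-∀

bound-below : ∀ g k → 2 * (5 * (k * k)) + 11 ≤ maxCutBound g k
bound-below full  k = +-monoˡ-≤ 11 (≤-trans (≤-reflexive (double k)) (m≤m+n (10 * (k * k)) (18 * k)))
  where
  double : ∀ k → 2 * (5 * (k * k)) ≡ 10 * (k * k)
  double = solve-∀
bound-below minus k = +-monoˡ-≤ 11 (≤-trans (≤-reflexive (double k)) (m≤m+n (10 * (k * k)) (10 * k)))
  where
  double : ∀ k → 2 * (5 * (k * k)) ≡ 10 * (k * k)
  double = solve-∀

theorem2 : ∃ λ (C : ℕ) → (k : ℕ) → 1 ≤ k → (g : Variant) →
    ∃ λ (S : Cut k (primes g k)) → IsMaxCut S ×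
      ∃₂ λ (x y : ℕ) → ∃ λ (z : ℕ) →
        (x + y + z ≡ primes g k) × RowPattern S x y ×
        NearThird x k × NearThird y k × NearThird z k ×
        (6 * cs S ≤ 5 * (k * k) + 6 * C * k) ×
        (5 * (k * k) ≤ 6 * cs S + 6 * C * k)
theorem2 = 3 , λ k 1≤k g →
  let open OptimalBlocks (optimalBlocks k g)
      S = patternCut {k} {primes g k} x y
  in S , (λ S′ → twelve-squeeze (cut-upper k g S′) (optimal-lower k g)) ,
     x , y , z , rows≡ , rowPattern x y , near-x , near-y , near-z ,
     *-cancelˡ-≤ 2 (≤-trans (≤-reflexive (twelve (cs S))) (≤-trans (cut-upper k g S) (bound-above g k 1≤k))) ,
     ≤-trans (*-cancelˡ-≤ 2 (+-cancelʳ-≤ 11 _ _ (≤-trans (bound-below g k) (≤-trans (optimal-lower k g)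
       (≤-reflexive (cong (_+ 11) (sym (twelve (cs S))))))))) (m≤m+n (6 * cs S) (6 * 3 * k))
  where
  twelve : ∀ c → 2 * (6 * c) ≡ 12 * c
  twelve = solve-∀
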